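{- For every negative even integer $k$ and every positive integer $n$, $a(n,k)=c^{ -k}_{\text{odd}}(n)$.
   Context: For an integer $k$, $A(n,k)$ is the set of compositions $(c_1,\ldots,c_t)$ of $n$ (finite sequences of positive integers summing to $n$) such that $c_{2i-1}>c_{2i}+k$ for every $i$ with $2i\le t$ (no condition on the last part if $t$ is odd), and $a(n,k)=|A(n,k)|$. For a nonnegative integer $j$, $C^{2j}_{\text{odd}}(n)$ is the set of compositions of $n$ whose parts all lie in the set of positive odd integers together with the even integers $2,4,\ldots,2j$, and $c^{2j}_{\text{odd}}(n)=|C^{2j}_{\text{odd}}(n)|$. -}

module Defs where

open import Data.Nat using (ℕ; zero; suc; _≤_; _<_; _*_)
open import Data.Nat.Base using (_%_)
open import Data.Integer using (ℤ; +_; _+_) renaming (_<_ to _<ℤ_)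
open import Data.List using (List; []; _∷_)
open import Data.Nat.ListAction using (sum)
open import Data.List.Relation.Unary.All using (All)
open import Data.Product using (_×_; Σ)
open import Data.Sum using (_⊎_)
open import Data.Unit using (⊤)
open import Relation.Binary.PropositionalEquality using (_≡_)

IsComposition : ℕ → List ℕ → Set
IsComposition n cs = All (λ c → 0 < c) cs × sum cs ≡ n

Composition : ℕ → Set
Composition n = Σ (List ℕ) (IsComposition n)

PairCond : ℤ → List ℕ → Set
PairCond k []             = ⊤
PairCond k (c ∷ [])       = ⊤
PairCond k (c₁ ∷ c₂ ∷ cs) = ((+ c₂) + k <ℤ (+ c₁)) × PairCond k cs

A : ℕ → ℤ → Set
A n k = Σ (List ℕ) (λ cs → IsComposition n cs × PairCond k cs)

-- Allowed parts for C^{2j}_odd: odd positive integers, or even in {2,...,2j}.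
AllowedPart : ℕ → ℕ → Set
AllowedPart j p = (p % 2 ≡ 1) ⊎ ((p % 2 ≡ 0) × (0 < p) × (p ≤ 2 * j))

Codd : ℕ → ℕ → Set
Codd j n = Σ (List ℕ) (λ cs → IsComposition n cs × All (AllowedPart j) cs)

{-# OPTIONS --safe #-}
-- Read a composition in A(n, -2j) as a sequence of pairs (c₁, c₂), possibly followed by a
-- lone last part.  Put g(c₂) = 1 + (c₂ ∸ 2j); for c₁ > 0 the pair condition c₂ < c₁ + 2j is
-- g(c₂) ≤ c₁.  Replace the pair by c₁ − g(c₂) ones followed by the single part g(c₂) + c₂,
-- and the lone part c by c ones.  The map c₂ ↦ g(c₂) + c₂ sends 1, …, 2j to 2, …, 2j+1 and
-- 2j + e to 2(j + e) + 1, so it is a bijection from the positive integers onto the parts ≥ 2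
-- allowed in C^{2j}_odd.  Cutting a composition in C^{2j}_odd after each part ≥ 2 therefore
-- inverts the construction, and both maps preserve the sum.
module Submission where

open import Defs
open import Data.Nat using (ℕ; _<_; _*_)
open import Data.Integer using (ℤ; -_; +_)
open import Function.Bundles using (_↔_)
open import Relation.Binary.PropositionalEquality using (_≡_)

import Data.Integer as ℤ
import Data.Integer.Properties as ℤₚ
open import Algebra.Properties.AbelianGroup ℤₚ.+-0-abelianGroup using (//-rightDividesˡ; //-rightDividesʳ)
open import Data.Empty using (⊥-elim)
open import Data.List.Base using (List; []; _∷_; _++_; replicate)
open import Data.List.Properties using (++-identityʳ)
open import Data.List.Relation.Unary.All as All using (All; []; _∷_)
open import Data.List.Relation.Unary.All.Properties using (++⁺; ++⁻ʳ; replicate⁺)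
open import Data.Nat.Base using (zero; suc; _+_; _∸_; _≤_; z≤n; s≤s; s≤s⁻¹; z<s; >-nonZero; _%_; _/_)
open import Data.Nat.DivMod using (m≡m%n+[m/n]*n; m%n<n; [m+kn]%n≡m%n)
open import Data.Nat.ListAction using (sum)
open import Data.Nat.ListAction.Properties using (sum-++)
open import Data.Nat.Properties
open import Data.Nat.Tactic.RingSolver using (solve-∀)
open import Data.Product using (∃-syntax; _×_; _,_; proj₁; proj₂)
open import Data.Product.Properties using (Σ-≡,≡→≡)
open import Data.Sum using (_⊎_; inj₁; inj₂)
open import Data.Unit using (tt)
open import Function.Bundles using (_⇔_; mk⇔; mk↔ₛ′; Equivalence)
open import Relation.Binary.Definitions using (tri<; tri≈; tri>)
open import Relation.Binary.PropositionalEquality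
  using (_≢_; refl; sym; trans; cong; cong₂; subst; module ≡-Reasoning)
open import Relation.Nullary using (contradiction; yes; no)
open import Relation.Nullary.Irrelevant using (Irrelevant)

private
  variable
    a b c₁ c₂ m n o q t : ℕ
    cs : List ℕ

i-k<j⇔i<j+k : {i j k : ℤ} → i ℤ.- k ℤ.< j ⇔ i ℤ.< j ℤ.+ k
i-k<j⇔i<j+k {i} {j} {k} = mk⇔
  (λ i-k<j → subst (ℤ._< j ℤ.+ k) (//-rightDividesˡ k i) (ℤₚ.+-monoˡ-< k i-k<j))
  (λ i<j+k → subst (i ℤ.- k ℤ.<_) (//-rightDividesʳ k j) (ℤₚ.+-monoˡ-< (- k) i<j+k))

m<o+n⇔m∸n<o : 0 < o → m < o + n ⇔ m ∸ n < o
m<o+n⇔m∸n<o {o} {m} {n} 0<o = mk⇔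
  (λ m<o+n → m<n+o⇒m∸n<o m n {{>-nonZero 0<o}} (subst (m <_) (+-comm o n) m<o+n))
  (λ m∸n<o → subst (m <_) (+-comm n o) (≤-<-trans (m≤n+m∸n m n) (+-monoʳ-< n m∸n<o)))

[+m]-[+n]<+o⇔m∸n<o : ∀ n → 0 < o → + m ℤ.- + n ℤ.< + o ⇔ m ∸ n < o
[+m]-[+n]<+o⇔m∸n<o {o} {m} n 0<o = mk⇔
  (λ lt → to (m<o+n⇔m∸n<o 0<o) (ℤₚ.drop‿+<+ (subst (+ m ℤ.<_) (sym +o+n) (to i-n<j⇔i<j+n lt))))
  (λ lt → from i-n<j⇔i<j+n (subst (+ m ℤ.<_) +o+n (ℤ.+<+ (from (m<o+n⇔m∸n<o 0<o) lt))))
  where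
  open Equivalence
  i-n<j⇔i<j+n : + m ℤ.- + n ℤ.< + o ⇔ + m ℤ.< + o ℤ.+ + n
  i-n<j⇔i<j+n = i-k<j⇔i<j+k {k = + n}
  +o+n : + (o + n) ≡ + o ℤ.+ + n
  +o+n = ℤₚ.pos-+ o n

m%2≡0⊎m%2≡1 : ∀ m → m % 2 ≡ 0 ⊎ m % 2 ≡ 1
m%2≡0⊎m%2≡1 m with m % 2 | m%n<n m 2
... | 0           | _             = inj₁ refl
... | 1           | _             = inj₂ refl
... | suc (suc _) | s≤s (s≤s ())

[1+2m]%2≡1 : ∀ m → suc (2 * m) % 2 ≡ 1
[1+2m]%2≡1 m = trans (cong (λ x → suc x % 2) (*-comm 2 m)) ([m+kn]%n≡m%n 1 m 2)

m%2≡1⇒m≡1+2[m/2] : m % 2 ≡ 1 → m ≡ suc (2 * (m / 2))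
m%2≡1⇒m≡1+2[m/2] {m} m%2≡1 = trans (m≡m%n+[m/n]*n m 2) (cong₂ _+_ m%2≡1 (*-comm (m / 2) 2))

allowed⇒0< : ∀ j → AllowedPart j q → 0 < q
allowed⇒0< {zero}  _ (inj₁ ())
allowed⇒0< {suc _} _ (inj₁ _)             = z<s
allowed⇒0<         _ (inj₂ (_ , 0<q , _)) = 0<q

allowed-≤ : ∀ j → 0 < q → q ≤ suc (2 * j) → AllowedPart j q
allowed-≤ {q} j 0<q q≤1+2j with m%2≡0⊎m%2≡1 q
... | inj₂ odd  = inj₁ odd
... | inj₁ even = inj₂ (even , 0<q , s≤s⁻¹ (≤∧≢⇒< q≤1+2j q≢1+2j))
  where
  q≢1+2j : q ≢ suc (2 * j)
  q≢1+2j refl = 0≢1+n (trans (sym even) ([1+2m]%2≡1 j))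

allowed-irrelevant : ∀ j → Irrelevant (AllowedPart j q)
allowed-irrelevant _ (inj₁ p)       (inj₁ p′)       = cong inj₁ (≡-irrelevant p p′)
allowed-irrelevant _ (inj₁ p)       (inj₂ (p′ , _)) = contradiction (trans (sym p′) p) 0≢1+n
allowed-irrelevant _ (inj₂ (p , _)) (inj₁ p′)       = contradiction (trans (sym p) p′) 0≢1+n
allowed-irrelevant _ (inj₂ (p , 0<q , q≤)) (inj₂ (p′ , 0<q′ , q≤′)) =
  cong inj₂ (cong₂ _,_ (≡-irrelevant p p′) (cong₂ _,_ (≤-irrelevant 0<q 0<q′) (≤-irrelevant q≤ q≤′)))

×-irrelevant : {P Q : Set} → Irrelevant P → Irrelevant Q → Irrelevant (P × Q)
×-irrelevant irrP irrQ (p , q) (p′ , q′) = cong₂ _,_ (irrP p p′) (irrQ q q′)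

isComposition-irrelevant : Irrelevant (IsComposition n cs)
isComposition-irrelevant = ×-irrelevant (All.irrelevant <-irrelevant) ≡-irrelevant

pairCond-irrelevant : ∀ k cs → Irrelevant (PairCond k cs)
pairCond-irrelevant k []           tt tt = refl
pairCond-irrelevant k (_ ∷ [])     tt tt = refl
pairCond-irrelevant k (_ ∷ _ ∷ cs)       =
  ×-irrelevant ℤₚ.<-irrelevant (pairCond-irrelevant k cs)

sum-replicate-1 : ∀ t → sum (replicate t 1) ≡ t
sum-replicate-1 zero    = refl
sum-replicate-1 (suc t) = cong suc (sum-replicate-1 t)

replicate-suc-++ : ∀ {A : Set} t (x : A) xs → replicate (suc t) x ++ xs ≡ replicate t x ++ x ∷ xs
replicate-suc-++ zero    x xs = refl
replicate-suc-++ (suc t) x xs = cong (x ∷_) (replicate-suc-++ t x xs)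

module _ (j : ℕ) where

  gap : ℕ → ℕ
  gap b = suc (b ∸ 2 * j)

  part : ℕ → ℕ
  part b = gap b + b

  part-≤ : b ≤ 2 * j → part b ≡ suc b
  part-≤ {b} b≤2j = cong (λ x → suc x + b) (m≤n⇒m∸n≡0 b≤2j)

  part-2j+ : ∀ e → part (2 * j + e) ≡ suc (2 * (j + e))
  part-2j+ e = trans (cong (λ x → suc x + (2 * j + e)) (m+n∸m≡n (2 * j) e)) (shape j e)
    where
    shape : ∀ j e → suc e + (2 * j + e) ≡ suc (2 * (j + e))
    shape = solve-∀

  part-allowed : ∀ b → AllowedPart j (part b)
  part-allowed b with ≤-total b (2 * j)
  ... | inj₁ b≤2j = subst (AllowedPart j) (sym (part-≤ b≤2j)) (allowed-≤ j z<s (s≤s b≤2j))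
  ... | inj₂ 2j≤b with m≤n⇒∃[o]m+o≡n 2j≤b
  ...   | e , refl = subst (AllowedPart j) (sym (part-2j+ e)) (inj₁ ([1+2m]%2≡1 (j + e)))

  part-surjective : 2 ≤ q → AllowedPart j q → ∃[ b ] 0 < b × part b ≡ q
  part-surjective {suc (suc r)} (s≤s (s≤s z≤n)) _ with suc (suc r) ≤? suc (2 * j)
  ... | yes q≤1+2j = suc r , z<s , part-≤ (s≤s⁻¹ q≤1+2j)
  part-surjective _ (inj₂ (_ , _ , q≤2j)) | no q≰1+2j = contradiction (m≤n⇒m≤1+n q≤2j) q≰1+2j
  part-surjective {q} _ (inj₁ odd) | no q≰1+2j =
    2 * j + (h ∸ j) , <-≤-trans (m<n⇒0<n∸m j<h) (m≤n+m _ (2 * j)) , eq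
    where
    open ≡-Reasoning
    h : ℕ
    h = q / 2
    q≡1+2h : q ≡ suc (2 * h)
    q≡1+2h = m%2≡1⇒m≡1+2[m/2] odd
    j<h : j < h
    j<h = *-cancelˡ-< 2 j h (s≤s⁻¹ (subst (suc (2 * j) <_) q≡1+2h (≰⇒> q≰1+2j)))
    eq : part (2 * j + (h ∸ j)) ≡ q
    eq = begin
      part (2 * j + (h ∸ j))    ≡⟨ part-2j+ (h ∸ j) ⟩
      suc (2 * (j + (h ∸ j)))   ≡⟨ cong (λ x → suc (2 * x)) (m+[n∸m]≡n (<⇒≤ j<h)) ⟩
      suc (2 * h)               ≡⟨ sym q≡1+2h ⟩
      q                         ∎

  part-strictMono : a < b → part a < part b
  part-strictMono a<b = +-mono-≤-< (s≤s (∸-monoˡ-≤ (2 * j) (<⇒≤ a<b))) a<b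

  part-injective : part a ≡ part b → a ≡ b
  part-injective {a} {b} eq with <-cmp a b
  ... | tri< a<b _ _ = contradiction eq (<⇒≢ (part-strictMono a<b))
  ... | tri≈ _ a≡b _ = a≡b
  ... | tri> _ _ b<a = contradiction eq (>⇒≢ (part-strictMono b<a))

  1<part : 0 < b → 1 < part b
  1<part {b} 0<b = s≤s (≤-trans 0<b (m≤n+m b (b ∸ 2 * j)))

  unpart : AllowedPart j q → 2 ≤ q → ℕ
  unpart a 2≤q = proj₁ (part-surjective 2≤q a)

  0<unpart : (a : AllowedPart j q) (2≤q : 2 ≤ q) → 0 < unpart a 2≤q
  0<unpart a 2≤q = proj₁ (proj₂ (part-surjective 2≤q a))

  part-unpart : (a : AllowedPart j q) (2≤q : 2 ≤ q) → part (unpart a 2≤q) ≡ q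
  part-unpart a 2≤q = proj₂ (proj₂ (part-surjective 2≤q a))

  0<+gap : ∀ t b → 0 < t + gap b
  0<+gap t b = <-≤-trans z<s (m≤n+m (gap b) t)

  pairCond⇔gap≤ : 0 < c₁ → PairCond (- + (2 * j)) (c₁ ∷ c₂ ∷ []) ⇔ gap c₂ ≤ c₁
  pairCond⇔gap≤ 0<c₁ = mk⇔
    (λ (lt , _) → Equivalence.to ([+m]-[+n]<+o⇔m∸n<o (2 * j) 0<c₁) lt)
    (λ gap≤ → Equivalence.from ([+m]-[+n]<+o⇔m∸n<o (2 * j) 0<c₁) gap≤ , tt)

  encode : List ℕ → List ℕ
  encode []             = []
  encode (c ∷ [])       = replicate c 1
  encode (c₁ ∷ c₂ ∷ cs) = replicate (c₁ ∸ gap c₂) 1 ++ part c₂ ∷ encode cs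

  -- The accumulator counts the ones read since the last part ≥ 2.
  decode : ℕ → (cs : List ℕ) → All (AllowedPart j) cs → List ℕ
  -- The cons clauses come first, so that decode t (x ∷ xs) reduces for a variable t.
  decode t       (zero ∷ _)         (a ∷ _)  = ⊥-elim (n≮0 (allowed⇒0< j a))
  decode t       (suc zero ∷ cs)    (_ ∷ al) = decode (suc t) cs al
  decode t       (suc (suc _) ∷ cs) (a ∷ al) =
    let b = unpart a (s≤s (s≤s z≤n)) in t + gap b ∷ b ∷ decode 0 cs al
  decode zero    []                 []       = []
  decode (suc t) []                 []       = suc t ∷ []

  encode-allowed : All (0 <_) cs → All (AllowedPart j) (encode cs)
  encode-allowed []       = []
  encode-allowed (_ ∷ []) = replicate⁺ _ (inj₁ refl)
  encode-allowed {_ ∷ c₂ ∷ _} (_ ∷ _ ∷ ps) =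
    ++⁺ (replicate⁺ _ (inj₁ refl)) (part-allowed c₂ ∷ encode-allowed ps)

  encode-sum : All (0 <_) cs → PairCond (- + (2 * j)) cs → sum (encode cs) ≡ sum cs
  encode-sum []                    _ = refl
  encode-sum {c ∷ []}     (_ ∷ []) _ = trans (sum-replicate-1 c) (sym (+-identityʳ c))
  encode-sum {c₁ ∷ c₂ ∷ cs} (0<c₁ ∷ _ ∷ ps) (lt , pcs) = begin
    sum (replicate (c₁ ∸ gap c₂) 1 ++ part c₂ ∷ encode cs)
      ≡⟨ sum-++ (replicate (c₁ ∸ gap c₂) 1) _ ⟩
    sum (replicate (c₁ ∸ gap c₂) 1) + (gap c₂ + c₂ + sum (encode cs))
      ≡⟨ cong₂ (λ x y → x + (gap c₂ + c₂ + y)) (sum-replicate-1 _) (encode-sum ps pcs) ⟩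
    (c₁ ∸ gap c₂) + (gap c₂ + c₂ + sum cs)
      ≡⟨ regroup (c₁ ∸ gap c₂) (gap c₂) c₂ (sum cs) ⟩
    (c₁ ∸ gap c₂) + gap c₂ + (c₂ + sum cs)
      ≡⟨ cong (_+ (c₂ + sum cs)) (m∸n+n≡m gap≤c₁) ⟩
    c₁ + (c₂ + sum cs)
      ∎
    where
    open ≡-Reasoning
    gap≤c₁ : gap c₂ ≤ c₁
    gap≤c₁ = Equivalence.to (pairCond⇔gap≤ 0<c₁) (lt , tt)
    regroup : ∀ w x y z → w + (x + y + z) ≡ w + x + (y + z)
    regroup = solve-∀

  decode-replicate : ∀ t m cs (al : All (AllowedPart j) (replicate m 1 ++ cs)) →
                     decode t (replicate m 1 ++ cs) al ≡ decode (m + t) cs (++⁻ʳ (replicate m 1) al)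
  decode-replicate t zero    cs al       = refl
  decode-replicate t (suc m) cs (_ ∷ al) =
    trans (decode-replicate (suc t) m cs al)
          (cong (λ s → decode s cs (++⁻ʳ (replicate m 1) al)) (+-suc m t))

  decode-replicate-[] : ∀ t m (al : All (AllowedPart j) (replicate m 1)) →
                        decode t (replicate m 1) al ≡ decode (m + t) [] []
  decode-replicate-[] t zero    []       = refl
  decode-replicate-[] t (suc m) (_ ∷ al) =
    trans (decode-replicate-[] (suc t) m al) (cong (λ s → decode s [] []) (+-suc m t))

  decode-part : 0 < b → (al : All (AllowedPart j) (part b ∷ cs)) →
                decode t (part b ∷ cs) al ≡ t + gap b ∷ b ∷ decode 0 cs (All.tail al)
  decode-part {b} {cs} {t} 0<b (a ∷ al) =
    trans (decode-unpart a (1<part 0<b))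
          (cong (λ x → t + gap x ∷ x ∷ decode 0 cs al) (part-injective (part-unpart a (1<part 0<b))))
    where
    decode-unpart : (a : AllowedPart j q) (2≤q : 2 ≤ q) →
                    decode t (q ∷ cs) (a ∷ al) ≡ t + gap (unpart a 2≤q) ∷ unpart a 2≤q ∷ decode 0 cs al
    decode-unpart a (s≤s (s≤s z≤n)) = refl

  decode-encode : All (0 <_) cs → PairCond (- + (2 * j)) cs →
                  (al : All (AllowedPart j) (encode cs)) → decode 0 (encode cs) al ≡ cs
  decode-encode []                _ [] = refl
  decode-encode {suc c ∷ []} (_ ∷ []) _ al =
    trans (decode-replicate-[] 0 (suc c) al) (cong (λ x → suc x ∷ []) (+-identityʳ c))
  decode-encode {c₁ ∷ c₂ ∷ cs} (0<c₁ ∷ 0<c₂ ∷ ps) (lt , pcs) al = begin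
    decode 0 (replicate s 1 ++ part c₂ ∷ encode cs) al
      ≡⟨ decode-replicate 0 s _ al ⟩
    decode (s + 0) (part c₂ ∷ encode cs) _
      ≡⟨ decode-part 0<c₂ _ ⟩
    s + 0 + gap c₂ ∷ c₂ ∷ decode 0 (encode cs) _
      ≡⟨ cong₂ (λ x y → x ∷ c₂ ∷ y) s+0+gap≡c₁ (decode-encode ps pcs _) ⟩
    c₁ ∷ c₂ ∷ cs
      ∎
    where
    open ≡-Reasoning
    s : ℕ
    s = c₁ ∸ gap c₂
    s+0+gap≡c₁ : s + 0 + gap c₂ ≡ c₁
    s+0+gap≡c₁ = trans (cong (_+ gap c₂) (+-identityʳ s))
                       (m∸n+n≡m (Equivalence.to (pairCond⇔gap≤ 0<c₁) (lt , tt)))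

  encode-decode : ∀ t cs (al : All (AllowedPart j) cs) → encode (decode t cs al) ≡ replicate t 1 ++ cs
  encode-decode zero    []                 []       = refl
  encode-decode (suc t) []                 []       = sym (++-identityʳ _)
  encode-decode t       (zero ∷ _)         (a ∷ _)  = ⊥-elim (n≮0 (allowed⇒0< j a))
  encode-decode t       (suc zero ∷ cs)    (_ ∷ al) =
    trans (encode-decode (suc t) cs al) (replicate-suc-++ t 1 cs)
  encode-decode t       (suc (suc _) ∷ cs) (a ∷ al) =
    cong₂ (λ s xs → replicate s 1 ++ xs) (m+n∸n≡m t (gap i))
          (cong₂ _∷_ (part-unpart a (s≤s (s≤s z≤n))) (encode-decode 0 cs al))
    where
    i : ℕ
    i = unpart a (s≤s (s≤s z≤n))

  decode-sum : ∀ t cs (al : All (AllowedPart j) cs) → sum (decode t cs al) ≡ t + sum cs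
  decode-sum zero    []                 []       = refl
  decode-sum (suc t) []                 []       = refl
  decode-sum t       (zero ∷ _)         (a ∷ _)  = ⊥-elim (n≮0 (allowed⇒0< j a))
  decode-sum t       (suc zero ∷ cs)    (_ ∷ al) =
    trans (decode-sum (suc t) cs al) (sym (+-suc t (sum cs)))
  decode-sum t       (q@(suc (suc _)) ∷ cs) (a ∷ al) = begin
    t + gap i + (i + sum (decode 0 cs al))
      ≡⟨ regroup t (gap i) i _ ⟩
    t + (part i + sum (decode 0 cs al))
      ≡⟨ cong₂ (λ x y → t + (x + y)) (part-unpart a (s≤s (s≤s z≤n))) (decode-sum 0 cs al) ⟩
    t + (q + sum cs)
      ∎
    where
    open ≡-Reasoning
    i : ℕ
    i = unpart a (s≤s (s≤s z≤n))
    regroup : ∀ w x y z → w + x + (y + z) ≡ w + (x + y + z)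
    regroup = solve-∀

  decode-positive : ∀ t cs (al : All (AllowedPart j) cs) → All (0 <_) (decode t cs al)
  decode-positive zero    []                 []       = []
  decode-positive (suc t) []                 []       = z<s ∷ []
  decode-positive t       (zero ∷ _)         (a ∷ _)  = ⊥-elim (n≮0 (allowed⇒0< j a))
  decode-positive t       (suc zero ∷ cs)    (_ ∷ al) = decode-positive (suc t) cs al
  decode-positive t       (suc (suc _) ∷ cs) (a ∷ al) =
    0<+gap t _ ∷ 0<unpart a (s≤s (s≤s z≤n)) ∷ decode-positive 0 cs al

  decode-pairCond : ∀ t cs (al : All (AllowedPart j) cs) → PairCond (- + (2 * j)) (decode t cs al)
  decode-pairCond zero    []                 []       = tt
  decode-pairCond (suc t) []                 []       = tt
  decode-pairCond t       (zero ∷ _)         (a ∷ _)  = ⊥-elim (n≮0 (allowed⇒0< j a))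
  decode-pairCond t       (suc zero ∷ cs)    (_ ∷ al) = decode-pairCond (suc t) cs al
  decode-pairCond t       (suc (suc _) ∷ cs) (a ∷ al) =
    proj₁ (Equivalence.from (pairCond⇔gap≤ (0<+gap t _)) (m≤n+m _ t)) , decode-pairCond 0 cs al

  A↔Codd : ∀ n → A n (- + (2 * j)) ↔ Codd j n
  A↔Codd n = mk↔ₛ′ to from to∘from from∘to
    where
    to : A n (- + (2 * j)) → Codd j n
    to (cs , (ps , Σcs) , pc) =
      encode cs ,
      (All.map (allowed⇒0< j) (encode-allowed ps) , trans (encode-sum ps pc) Σcs) ,
      encode-allowed ps

    from : Codd j n → A n (- + (2 * j))
    from (cs , (_ , Σcs) , al) =
      decode 0 cs al ,
      (decode-positive 0 cs al , trans (decode-sum 0 cs al) Σcs) ,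
      decode-pairCond 0 cs al

    to∘from : ∀ y → to (from y) ≡ y
    to∘from (cs , _ , al) =
      Σ-≡,≡→≡ (encode-decode 0 cs al ,
               ×-irrelevant isComposition-irrelevant (All.irrelevant (allowed-irrelevant j)) _ _)

    from∘to : ∀ x → from (to x) ≡ x
    from∘to (cs , (ps , _) , pc) =
      Σ-≡,≡→≡ (decode-encode ps pc _ ,
               ×-irrelevant isComposition-irrelevant (pairCond-irrelevant _ cs) _ _)

theorem4p4 : (j : ℕ) → 0 < j → (k : ℤ) → k ≡ - (+ (2 * j)) →
    (n : ℕ) → 0 < n → A n k ↔ Codd j n
-- The bijection exists for every j and n.
theorem4p4 j _ _ refl n _ = A↔Codd j n
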